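{- For all sequences of type variables $\vec X,\vec Z$, types $A,B$ and type variables $Y,W$ such that $\forall\vec X.(A\Rightarrow Y)\equiv\forall\vec Z.(B\Rightarrow W)$, we have $\vec X=\vec Z$, $A\equiv B$ and $Y=W$.
   Context: Types: $A ::= X \mid A\Rightarrow A \mid A\wedge A \mid \forall X.A$, $X$ type variables, modulo $\alpha$-equivalence; $\Rightarrow$ associates to the right. Type isomorphism $\equiv$ is the smallest congruence on types containing: $A\wedge B\equiv B\wedge A$; $A\wedge(B\wedge C)\equiv(A\wedge B)\wedge C$; $A\Rightarrow(B\wedge C)\equiv(A\Rightarrow B)\wedge(A\Rightarrow C)$; $(A\wedge B)\Rightarrow C\equiv A\Rightarrow B\Rightarrow C$; $\forall X.(A\Rightarrow B)\equiv A\Rightarrow\forall X.B$ if $X\notin FTV(A)$; $\forall X.(A\wedge B)\equiv\forall X.A\wedge\forall X.B$. $\forall\vec X.A$ denotes $\forall X_1\dots\forall X_n.A$ ($n\ge0$). -}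

module Defs where

open import Data.Nat using (ℕ; zero; suc)

-- Types with de Bruijn indices for type variables (this makes types
-- identical exactly when they are α-equivalent).
--   var i   : type variable (de Bruijn index i)
--   A ⇒ B   : implication
--   A ∧ B   : conjunction
--   ∀' A    : universal quantification binding index 0 in A
infixr 5 _⇒_
infixr 6 _∧_

data Ty : Set where
  var : ℕ → Ty
  _⇒_ : Ty → Ty → Ty
  _∧_ : Ty → Ty → Ty
  ∀'  : Ty → Ty

liftVar : ℕ → ℕ → ℕ
liftVar zero    i       = suc i
liftVar (suc c) zero    = zero
liftVar (suc c) (suc i) = suc (liftVar c i)

lift : ℕ → Ty → Ty
lift c (var i) = var (liftVar c i)
lift c (A ⇒ B) = lift c A ⇒ lift c B
lift c (A ∧ B) = lift c A ∧ lift c B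
lift c (∀' A)  = ∀' (lift (suc c) A)

-- weakening: A seen under one more binder (the new bound variable X
-- therefore does not occur free in  wk A)
wk : Ty → Ty
wk = lift zero

∀ⁿ : ℕ → Ty → Ty
∀ⁿ zero    A = A
∀ⁿ (suc n) A = ∀' (∀ⁿ n A)

infix 4 _≅_
data _≅_ : Ty → Ty → Set where
  ≅-refl  : ∀ {A} → A ≅ A
  ≅-sym   : ∀ {A B} → A ≅ B → B ≅ A
  ≅-trans : ∀ {A B C} → A ≅ B → B ≅ C → A ≅ C
  ⇒-cong  : ∀ {A A′ B B′} → A ≅ A′ → B ≅ B′ → (A ⇒ B) ≅ (A′ ⇒ B′)
  ∧-cong  : ∀ {A A′ B B′} → A ≅ A′ → B ≅ B′ → (A ∧ B) ≅ (A′ ∧ B′)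
  ∀-cong  : ∀ {A A′} → A ≅ A′ → ∀' A ≅ ∀' A′
  comm    : ∀ {A B} → (A ∧ B) ≅ (B ∧ A)
  asso    : ∀ {A B C} → (A ∧ (B ∧ C)) ≅ ((A ∧ B) ∧ C)
  dist    : ∀ {A B C} → (A ⇒ (B ∧ C)) ≅ ((A ⇒ B) ∧ (A ⇒ C))
  curry   : ∀ {A B C} → ((A ∧ B) ⇒ C) ≅ (A ⇒ B ⇒ C)
  -- ∀X.(A ⇒ B) ≡ A ⇒ ∀X.B  when X ∉ FTV(A): A under the binder is wk A
  p-comm  : ∀ {A B} → ∀' (wk A ⇒ B) ≅ (A ⇒ ∀' B)
  p-dist  : ∀ {A B} → ∀' (A ∧ B) ≅ (∀' A ∧ ∀' B)

-- Every type is isomorphic to a conjunction of atoms ∀ⁿ(H₁ ⇒ … ⇒ Hₗ ⇒ X), where each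
-- hypothesis Hᵢ is again an atom; the list of these atoms is the normal form nf A, and
-- A ≅ conj (nf A). Each isomorphism axiom only permutes the atoms of a normal form, up to
-- replacing the hypotheses of an atom by an isomorphic list of hypotheses. Since
-- nf (∀ⁿ n (A ⇒ var y)) is the single atom with prefix n, target y and hypotheses nf A,
-- an isomorphism between two such types forces equal prefixes, equal targets and
-- isomorphic hypotheses, i.e. A ≅ conj (nf A) ≅ conj (nf B) ≅ B.
module Submission where

open import Defs
open import Data.Nat using (ℕ; zero; suc; _+_; _≤_; z≤n; s≤s)
open import Data.Nat.Properties using (+-suc; +-monoʳ-≤)
open import Data.List using (List; []; _∷_; _++_; [_]; map; length)
open import Data.List.Properties using (++-assoc; ++-identityʳ; length-++; map-++; map-∘; map-cong)
open import Data.List.Relation.Unary.Any using (here)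
open import Data.Product using (_×_; _,_)
open import Level using (0ℓ)
open import Relation.Binary.Bundles using (Setoid)
open import Relation.Binary.PropositionalEquality
  using (_≡_; refl; sym; trans; cong; cong₂; subst₂; module ≡-Reasoning)
import Relation.Binary.Reasoning.Setoid as SetoidReasoning

≅-setoid : Setoid 0ℓ 0ℓ
≅-setoid = record
  { Carrier       = Ty
  ; _≈_           = _≅_
  ; isEquivalence = record { refl = ≅-refl ; sym = ≅-sym ; trans = ≅-trans }
  }

module ≅-Reasoning = SetoidReasoning ≅-setoid

∀ⁿ-cong : ∀ k {A B} → A ≅ B → ∀ⁿ k A ≅ ∀ⁿ k B
∀ⁿ-cong zero    p = p
∀ⁿ-cong (suc k) p = ∀-cong (∀ⁿ-cong k p)

liftVar-comm : ∀ {d c} → d ≤ c → ∀ i → liftVar (suc c) (liftVar d i) ≡ liftVar d (liftVar c i)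
liftVar-comm z≤n      i       = refl
liftVar-comm (s≤s le) zero    = refl
liftVar-comm (s≤s le) (suc i) = cong suc (liftVar-comm le i)

lift-comm : ∀ {d c} → d ≤ c → ∀ A → lift (suc c) (lift d A) ≡ lift d (lift c A)
lift-comm le (var i) = cong var (liftVar-comm le i)
lift-comm le (A ⇒ B) = cong₂ _⇒_ (lift-comm le A) (lift-comm le B)
lift-comm le (A ∧ B) = cong₂ _∧_ (lift-comm le A) (lift-comm le B)
lift-comm le (∀' A)  = cong ∀' (lift-comm (s≤s le) A)

lift-cong : ∀ c {A B} → A ≅ B → lift c A ≅ lift c B
lift-cong c ≅-refl        = ≅-refl
lift-cong c (≅-sym p)     = ≅-sym (lift-cong c p)
lift-cong c (≅-trans p q) = ≅-trans (lift-cong c p) (lift-cong c q)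
lift-cong c (⇒-cong p q)  = ⇒-cong (lift-cong c p) (lift-cong c q)
lift-cong c (∧-cong p q)  = ∧-cong (lift-cong c p) (lift-cong c q)
lift-cong c (∀-cong p)    = ∀-cong (lift-cong (suc c) p)
lift-cong c comm          = comm
lift-cong c asso          = asso
lift-cong c dist          = dist
lift-cong c curry         = curry
lift-cong c (p-comm {A})  rewrite lift-comm {c = c} z≤n A = p-comm
lift-cong c p-dist        = p-dist

lift-∀ⁿ : ∀ k c A → lift c (∀ⁿ k A) ≡ ∀ⁿ k (lift (k + c) A)
lift-∀ⁿ zero    c A = refl
lift-∀ⁿ (suc k) c A rewrite sym (+-suc k c) = cong ∀' (lift-∀ⁿ k (suc c) A)

wkⁿ : ℕ → Ty → Ty
wkⁿ zero    A = A
wkⁿ (suc k) A = wkⁿ k (wk A)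

⇒-∀ⁿ : ∀ k A C → (A ⇒ ∀ⁿ k C) ≅ ∀ⁿ k (wkⁿ k A ⇒ C)
⇒-∀ⁿ zero    A C = ≅-refl
⇒-∀ⁿ (suc k) A C = ≅-trans (≅-sym p-comm) (∀-cong (⇒-∀ⁿ k (wk A) C))

-- at k [a₁, …, aₗ] y  stands for  ∀ⁿ k (a₁ ⇒ … ⇒ aₗ ⇒ var y), see atomTy below.
data Atom : Set where
  at : ℕ → List Atom → ℕ → Atom

mutual
  liftAtom : ℕ → Atom → Atom
  liftAtom c (at k H y) = at k (liftAtoms (k + c) H) (liftVar (k + c) y)

  liftAtoms : ℕ → List Atom → List Atom
  liftAtoms c []       = []
  liftAtoms c (a ∷ as) = liftAtom c a ∷ liftAtoms c as

liftAtoms-++ : ∀ c G H → liftAtoms c (G ++ H) ≡ liftAtoms c G ++ liftAtoms c H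
liftAtoms-++ c []      H = refl
liftAtoms-++ c (a ∷ G) H = cong (liftAtom c a ∷_) (liftAtoms-++ c G H)

length-liftAtoms : ∀ c H → length (liftAtoms c H) ≡ length H
length-liftAtoms c []      = refl
length-liftAtoms c (a ∷ H) = cong suc (length-liftAtoms c H)

liftAtoms-natural : ∀ {c d} {f g : Atom → Atom} →
                    (∀ a → f (liftAtom c a) ≡ liftAtom d (g a)) →
                    ∀ H → map f (liftAtoms c H) ≡ liftAtoms d (map g H)
liftAtoms-natural fg []      = refl
liftAtoms-natural fg (a ∷ H) = cong₂ _∷_ (fg a) (liftAtoms-natural fg H)

mutual
  liftAtom-comm : ∀ {d c} → d ≤ c → ∀ a →
                  liftAtom (suc c) (liftAtom d a) ≡ liftAtom d (liftAtom c a)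
  liftAtom-comm {d} {c} le (at k H y) rewrite +-suc k c =
    cong₂ (at k) (liftAtoms-comm (+-monoʳ-≤ k le) H) (liftVar-comm (+-monoʳ-≤ k le) y)

  liftAtoms-comm : ∀ {d c} → d ≤ c → ∀ H →
                   liftAtoms (suc c) (liftAtoms d H) ≡ liftAtoms d (liftAtoms c H)
  liftAtoms-comm le []      = refl
  liftAtoms-comm le (a ∷ H) = cong₂ _∷_ (liftAtom-comm le a) (liftAtoms-comm le H)

wkAtoms : ℕ → List Atom → List Atom
wkAtoms zero    H = H
wkAtoms (suc k) H = wkAtoms k (liftAtoms 0 H)

wkAtoms-++ : ∀ k G H → wkAtoms k (G ++ H) ≡ wkAtoms k G ++ wkAtoms k H
wkAtoms-++ zero    G H = refl
wkAtoms-++ (suc k) G H rewrite liftAtoms-++ 0 G H = wkAtoms-++ k (liftAtoms 0 G) (liftAtoms 0 H)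

wkAtoms-lift : ∀ k c H → liftAtoms (k + c) (wkAtoms k H) ≡ wkAtoms k (liftAtoms c H)
wkAtoms-lift zero    c H = refl
wkAtoms-lift (suc k) c H rewrite sym (+-suc k c) =
  trans (wkAtoms-lift k (suc c) (liftAtoms 0 H)) (cong (wkAtoms k) (liftAtoms-comm z≤n H))

addHyps : List Atom → Atom → Atom
addHyps G (at k H y) = at k (wkAtoms k G ++ H) y

∀-atom : Atom → Atom
∀-atom (at k H y) = at (suc k) H y

nf : Ty → List Atom
nf (var i) = [ at 0 [] i ]
nf (A ⇒ B) = map (addHyps (nf A)) (nf B)
nf (A ∧ B) = nf A ++ nf B
nf (∀' A)  = map ∀-atom (nf A)

addHyps-lift : ∀ c G a → addHyps (liftAtoms c G) (liftAtom c a) ≡ liftAtom c (addHyps G a)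
addHyps-lift c G (at k H y) = cong (λ L → at k L (liftVar (k + c) y)) (begin
  wkAtoms k (liftAtoms c G) ++ liftAtoms (k + c) H
    ≡⟨ cong (_++ liftAtoms (k + c) H) (sym (wkAtoms-lift k c G)) ⟩
  liftAtoms (k + c) (wkAtoms k G) ++ liftAtoms (k + c) H
    ≡⟨ sym (liftAtoms-++ (k + c) (wkAtoms k G) H) ⟩
  liftAtoms (k + c) (wkAtoms k G ++ H) ∎)
  where open ≡-Reasoning

∀-atom-lift : ∀ c a → ∀-atom (liftAtom (suc c) a) ≡ liftAtom c (∀-atom a)
∀-atom-lift c (at k H y) rewrite +-suc k c = refl

nf-lift : ∀ c A → nf (lift c A) ≡ liftAtoms c (nf A)
nf-lift c (var i) = refl
nf-lift c (A ⇒ B) rewrite nf-lift c A | nf-lift c B =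
  liftAtoms-natural (addHyps-lift c (nf A)) (nf B)
nf-lift c (A ∧ B) rewrite nf-lift c A | nf-lift c B = sym (liftAtoms-++ c (nf A) (nf B))
nf-lift c (∀' A)  rewrite nf-lift (suc c) A = liftAtoms-natural (∀-atom-lift c) (nf A)

nf-wkⁿ : ∀ k A → nf (wkⁿ k A) ≡ wkAtoms k (nf A)
nf-wkⁿ zero    A = refl
nf-wkⁿ (suc k) A = trans (nf-wkⁿ k (wk A)) (cong (wkAtoms k) (nf-lift 0 A))

mutual
  atomTy : Atom → Ty
  atomTy (at k H y) = ∀ⁿ k (H ⇒* var y)

  infixr 5 _⇒*_
  _⇒*_ : List Atom → Ty → Ty
  []      ⇒* C = C
  (a ∷ H) ⇒* C = atomTy a ⇒ H ⇒* C

-- Normal forms are never empty; the junk value ∀X.X for [] is closed, so that conj-lift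
-- holds for every list.
conj : List Atom → Ty
conj []           = ∀' (var 0)
conj (a ∷ [])     = atomTy a
conj (a ∷ b ∷ bs) = atomTy a ∧ conj (b ∷ bs)

data NonEmpty : List Atom → Set where
  nonEmpty : ∀ {a as} → NonEmpty (a ∷ as)

map-nonEmpty : ∀ f {H} → NonEmpty H → NonEmpty (map f H)
map-nonEmpty f nonEmpty = nonEmpty

++-nonEmpty : ∀ {G} H → NonEmpty G → NonEmpty (G ++ H)
++-nonEmpty H nonEmpty = nonEmpty

nf-nonEmpty : ∀ A → NonEmpty (nf A)
nf-nonEmpty (var i) = nonEmpty
nf-nonEmpty (A ⇒ B) = map-nonEmpty (addHyps (nf A)) (nf-nonEmpty B)
nf-nonEmpty (A ∧ B) = ++-nonEmpty (nf B) (nf-nonEmpty A)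
nf-nonEmpty (∀' A)  = map-nonEmpty ∀-atom (nf-nonEmpty A)

mutual
  atomTy-lift : ∀ c a → atomTy (liftAtom c a) ≡ lift c (atomTy a)
  atomTy-lift c (at k H y) =
    sym (trans (lift-∀ⁿ k c (H ⇒* var y)) (cong (∀ⁿ k) (⇒*-lift (k + c) H (var y))))

  ⇒*-lift : ∀ c H C → lift c (H ⇒* C) ≡ liftAtoms c H ⇒* lift c C
  ⇒*-lift c []      C = refl
  ⇒*-lift c (a ∷ H) C = cong₂ _⇒_ (sym (atomTy-lift c a)) (⇒*-lift c H C)

conj-lift : ∀ c H → conj (liftAtoms c H) ≡ lift c (conj H)
conj-lift c []           = refl
conj-lift c (a ∷ [])     = atomTy-lift c a
conj-lift c (a ∷ b ∷ bs) = cong₂ _∧_ (atomTy-lift c a) (conj-lift c (b ∷ bs))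

⇒*-++ : ∀ G H C → (G ++ H) ⇒* C ≡ G ⇒* H ⇒* C
⇒*-++ []      H C = refl
⇒*-++ (a ∷ G) H C = cong (atomTy a ⇒_) (⇒*-++ G H C)

conj-⇒ : ∀ {H} → NonEmpty H → ∀ C → (conj H ⇒ C) ≅ H ⇒* C
conj-⇒ (nonEmpty {a} {[]})     C = ≅-refl
conj-⇒ (nonEmpty {a} {b ∷ bs}) C = ≅-trans curry (⇒-cong ≅-refl (conj-⇒ (nonEmpty {b} {bs}) C))

conj-++ : ∀ {G H} → NonEmpty G → NonEmpty H → (conj G ∧ conj H) ≅ conj (G ++ H)
conj-++ (nonEmpty {a} {[]})     nonEmpty = ≅-refl
conj-++ (nonEmpty {a} {b ∷ bs}) neH      =
  ≅-trans (≅-sym asso) (∧-cong ≅-refl (conj-++ (nonEmpty {b} {bs}) neH))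

conj-map : (F : Ty → Ty) → (∀ {X Y} → F (X ∧ Y) ≅ (F X ∧ F Y)) →
           ∀ {f} → (∀ a → F (atomTy a) ≅ atomTy (f a)) →
           ∀ {H} → NonEmpty H → F (conj H) ≅ conj (map f H)
conj-map F F-∧ F-atom (nonEmpty {a} {[]})     = F-atom a
conj-map F F-∧ {f} F-atom (nonEmpty {a} {b ∷ bs}) =
  ≅-trans F-∧ (∧-cong (F-atom a) (conj-map F F-∧ {f} F-atom (nonEmpty {b} {bs})))

lift-conj-nf : ∀ c {A} → A ≅ conj (nf A) → lift c A ≅ conj (nf (lift c A))
lift-conj-nf c {A} p = begin
  lift c A                  ≈⟨ lift-cong c p ⟩
  lift c (conj (nf A))      ≡⟨ sym (conj-lift c (nf A)) ⟩
  conj (liftAtoms c (nf A)) ≡⟨ cong conj (sym (nf-lift c A)) ⟩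
  conj (nf (lift c A))      ∎
  where open ≅-Reasoning

wkⁿ-conj-nf : ∀ k {A} → A ≅ conj (nf A) → wkⁿ k A ≅ conj (nf (wkⁿ k A))
wkⁿ-conj-nf zero    p = p
wkⁿ-conj-nf (suc k) p = wkⁿ-conj-nf k (lift-conj-nf 0 p)

⇒-atomTy : ∀ {A} → A ≅ conj (nf A) → ∀ a → (A ⇒ atomTy a) ≅ atomTy (addHyps (nf A) a)
⇒-atomTy {A} p (at k H y) = begin
  A ⇒ ∀ⁿ k (H ⇒* var y)
    ≈⟨ ⇒-∀ⁿ k A (H ⇒* var y) ⟩
  ∀ⁿ k (wkⁿ k A ⇒ H ⇒* var y)
    ≈⟨ ∀ⁿ-cong k (⇒-cong (wkⁿ-conj-nf k p) ≅-refl) ⟩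
  ∀ⁿ k (conj (nf (wkⁿ k A)) ⇒ H ⇒* var y)
    ≈⟨ ∀ⁿ-cong k (conj-⇒ (nf-nonEmpty (wkⁿ k A)) (H ⇒* var y)) ⟩
  ∀ⁿ k (nf (wkⁿ k A) ⇒* H ⇒* var y)
    ≡⟨ cong (λ G → ∀ⁿ k (G ⇒* H ⇒* var y)) (nf-wkⁿ k A) ⟩
  ∀ⁿ k (wkAtoms k (nf A) ⇒* H ⇒* var y)
    ≡⟨ cong (∀ⁿ k) (sym (⇒*-++ (wkAtoms k (nf A)) H (var y))) ⟩
  ∀ⁿ k ((wkAtoms k (nf A) ++ H) ⇒* var y) ∎
  where open ≅-Reasoning

conj-nf : ∀ A → A ≅ conj (nf A)
conj-nf (var i) = ≅-refl
conj-nf (A ⇒ B) = ≅-trans (⇒-cong ≅-refl (conj-nf B))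
                          (conj-map (A ⇒_) dist (⇒-atomTy (conj-nf A)) (nf-nonEmpty B))
conj-nf (A ∧ B) = ≅-trans (∧-cong (conj-nf A) (conj-nf B)) (conj-++ (nf-nonEmpty A) (nf-nonEmpty B))
conj-nf (∀' A)  = ≅-trans (∀-cong (conj-nf A))
                          (conj-map ∀' p-dist (λ { (at _ _ _) → ≅-refl }) (nf-nonEmpty A))

-- Hypothesis lists are compared through their readback; equal lengths keep [] apart from
-- lists whose conjunction happens to be isomorphic to the junk value conj [].
infix 4 _≅ᴴ_
record _≅ᴴ_ (G H : List Atom) : Set where
  constructor _,_
  field
    length-≡ : length G ≡ length H
    conj-≅   : conj G ≅ conj H

≅ᴴ-refl : ∀ {H} → H ≅ᴴ H
≅ᴴ-refl = refl , ≅-refl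

≅ᴴ-sym : ∀ {G H} → G ≅ᴴ H → H ≅ᴴ G
≅ᴴ-sym (l , p) = sym l , ≅-sym p

≅ᴴ-trans : ∀ {F G H} → F ≅ᴴ G → G ≅ᴴ H → F ≅ᴴ H
≅ᴴ-trans (l , p) (l′ , p′) = trans l l′ , ≅-trans p p′

conj-++-cong : ∀ {G G′ H H′} → G ≅ᴴ G′ → H ≅ᴴ H′ → conj (G ++ H) ≅ conj (G′ ++ H′)
conj-++-cong {[]} {[]} _ (_ , q) = q
conj-++-cong {G@(_ ∷ _)} {G′@(_ ∷ _)} {[]} {[]} (_ , p) _ =
  subst₂ _≅_ (cong conj (sym (++-identityʳ G))) (cong conj (sym (++-identityʳ G′))) p
conj-++-cong {a ∷ as} {a′ ∷ as′} {b ∷ bs} {b′ ∷ bs′} (_ , p) (_ , q) = begin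
  conj (a ∷ as ++ b ∷ bs)           ≈⟨ conj-++ (nonEmpty {a} {as}) (nonEmpty {b} {bs}) ⟨
  conj (a ∷ as) ∧ conj (b ∷ bs)     ≈⟨ ∧-cong p q ⟩
  conj (a′ ∷ as′) ∧ conj (b′ ∷ bs′) ≈⟨ conj-++ (nonEmpty {a′} {as′}) (nonEmpty {b′} {bs′}) ⟩
  conj (a′ ∷ as′ ++ b′ ∷ bs′)       ∎
  where open ≅-Reasoning
conj-++-cong {[]}    {_ ∷ _} (() , _) _
conj-++-cong {_ ∷ _} {[]}    (() , _) _
conj-++-cong {_ ∷ _} {_ ∷ _} {[]}    {_ ∷ _} _ (() , _)
conj-++-cong {_ ∷ _} {_ ∷ _} {_ ∷ _} {[]}    _ (() , _)

++-cong-≅ᴴ : ∀ {G G′ H H′} → G ≅ᴴ G′ → H ≅ᴴ H′ → G ++ H ≅ᴴ G′ ++ H′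
++-cong-≅ᴴ {G} {G′} p@(l , _) q@(l′ , _) =
  trans (length-++ G) (trans (cong₂ _+_ l l′) (sym (length-++ G′))) , conj-++-cong p q

liftAtoms-cong : ∀ c {G H} → G ≅ᴴ H → liftAtoms c G ≅ᴴ liftAtoms c H
liftAtoms-cong c {G} {H} (l , p) =
  trans (length-liftAtoms c G) (trans l (sym (length-liftAtoms c H))) ,
  subst₂ _≅_ (sym (conj-lift c G)) (sym (conj-lift c H)) (lift-cong c p)

wkAtoms-cong : ∀ k {G H} → G ≅ᴴ H → wkAtoms k G ≅ᴴ wkAtoms k H
wkAtoms-cong zero    p = p
wkAtoms-cong (suc k) p = wkAtoms-cong k (liftAtoms-cong 0 p)

infix 4 _~_
data _~_ : Atom → Atom → Set where
  at-cong : ∀ {k G H y} → G ≅ᴴ H → at k G y ~ at k H y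

~-refl : ∀ {a} → a ~ a
~-refl {at k H y} = at-cong ≅ᴴ-refl

~-sym : ∀ {a b} → a ~ b → b ~ a
~-sym (at-cong p) = at-cong (≅ᴴ-sym p)

~-trans : ∀ {a b c} → a ~ b → b ~ c → a ~ c
~-trans (at-cong p) (at-cong q) = at-cong (≅ᴴ-trans p q)

atom-setoid : Setoid 0ℓ 0ℓ
atom-setoid = record
  { Carrier       = Atom
  ; _≈_           = _~_
  ; isEquivalence = record { refl = ~-refl ; sym = ~-sym ; trans = ~-trans }
  }

open import Data.List.Relation.Binary.Permutation.Setoid atom-setoid
  using (_↭_; prep; ↭-refl; ↭-reflexive; ↭-sym; ↭-trans)
open import Data.List.Relation.Binary.Permutation.Setoid.Properties atom-setoid
  using (++⁺; ++-comm; map⁺; ∈-resp-↭; xs↭ys⇒|xs|≡|ys|)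

map-pointwise-↭ : ∀ {f g : Atom → Atom} → (∀ a → f a ~ g a) → ∀ H → map f H ↭ map g H
map-pointwise-↭ f~g []      = ↭-refl
map-pointwise-↭ f~g (a ∷ H) = prep (f~g a) (map-pointwise-↭ f~g H)

addHyps-congʳ : ∀ G {a b} → a ~ b → addHyps G a ~ addHyps G b
addHyps-congʳ G (at-cong p) = at-cong (++-cong-≅ᴴ ≅ᴴ-refl p)

addHyps-congˡ : ∀ {G G′} → G ≅ᴴ G′ → ∀ a → addHyps G a ~ addHyps G′ a
addHyps-congˡ p (at k H y) = at-cong (++-cong-≅ᴴ (wkAtoms-cong k p) ≅ᴴ-refl)

∀-atom-cong : ∀ {a b} → a ~ b → ∀-atom a ~ ∀-atom b
∀-atom-cong (at-cong p) = at-cong p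

addHyps-++ : ∀ G H a → addHyps (G ++ H) a ≡ addHyps G (addHyps H a)
addHyps-++ G H (at k F y) =
  cong (λ L → at k L y)
       (trans (cong (_++ F) (wkAtoms-++ k G H)) (++-assoc (wkAtoms k G) (wkAtoms k H) F))

∀-atom-addHyps : ∀ A a → ∀-atom (addHyps (nf (wk A)) a) ≡ addHyps (nf A) (∀-atom a)
∀-atom-addHyps A (at k H y) rewrite nf-lift 0 A = refl

nf-↭ : ∀ {A B} → A ≅ B → nf A ↭ nf B
nf-↭ ≅-refl                 = ↭-refl
nf-↭ (≅-sym p)              = ↭-sym (nf-↭ p)
nf-↭ (≅-trans p q)          = ↭-trans (nf-↭ p) (nf-↭ q)
nf-↭ (⇒-cong {A} {A′} {B′ = B′} p q) =
  ↭-trans (map⁺ atom-setoid (addHyps-congʳ (nf A)) (nf-↭ q))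
          (map-pointwise-↭ (addHyps-congˡ nfA≅ᴴnfA′) (nf B′))
  where
  nfA≅ᴴnfA′ : nf A ≅ᴴ nf A′
  nfA≅ᴴnfA′ = xs↭ys⇒|xs|≡|ys| (nf-↭ p) , ≅-trans (≅-sym (conj-nf A)) (≅-trans p (conj-nf A′))
nf-↭ (∧-cong p q)           = ++⁺ (nf-↭ p) (nf-↭ q)
nf-↭ (∀-cong p)             = map⁺ atom-setoid ∀-atom-cong (nf-↭ p)
nf-↭ (comm {A} {B})         = ++-comm (nf A) (nf B)
nf-↭ (asso {A} {B} {C})     = ↭-reflexive (sym (++-assoc (nf A) (nf B) (nf C)))
nf-↭ (dist {A} {B} {C})     = ↭-reflexive (map-++ (addHyps (nf A)) (nf B) (nf C))
nf-↭ (curry {A} {B} {C})    =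
  ↭-reflexive (trans (map-cong (addHyps-++ (nf A) (nf B)) (nf C)) (map-∘ (nf C)))
nf-↭ (p-comm {A} {B})       =
  ↭-reflexive (trans (sym (map-∘ (nf B)))
                     (trans (map-cong (∀-atom-addHyps A) (nf B)) (map-∘ (nf B))))
nf-↭ (p-dist {A} {B})       = ↭-reflexive (map-++ ∀-atom (nf A) (nf B))

nf-∀ⁿ⇒var : ∀ n A y → nf (∀ⁿ n (A ⇒ var y)) ≡ [ at n (nf A ++ []) y ]
nf-∀ⁿ⇒var zero    A y = refl
nf-∀ⁿ⇒var (suc n) A y rewrite nf-∀ⁿ⇒var n A y = refl

singleton-↭ : ∀ {a b} → [ a ] ↭ [ b ] → a ~ b
singleton-↭ p with ∈-resp-↭ p (here ~-refl)
... | here a~b = a~b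

mainTheorem6 : (n m : ℕ) (A B : Ty) (y w : ℕ) →
    ∀ⁿ n (A ⇒ var y) ≅ ∀ⁿ m (B ⇒ var w) →
    (n ≡ m) × (A ≅ B) × (y ≡ w)
mainTheorem6 n m A B y w iso
  with singleton-↭ (subst₂ _↭_ (nf-∀ⁿ⇒var n A y) (nf-∀ⁿ⇒var m B w) (nf-↭ iso))
... | at-cong (_ , hyps≅) = refl , A≅B , refl
  where
  A≅B : A ≅ B
  A≅B = begin
    A                  ≈⟨ conj-nf A ⟩
    conj (nf A)        ≡⟨ cong conj (sym (++-identityʳ (nf A))) ⟩
    conj (nf A ++ [])  ≈⟨ hyps≅ ⟩
    conj (nf B ++ [])  ≡⟨ cong conj (++-identityʳ (nf B)) ⟩
    conj (nf B)        ≈⟨ ≅-sym (conj-nf B) ⟩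
    B                  ∎
    where open ≅-Reasoning
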